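{- Let $n\ge 3$ and let $\mathcal{H}(\mathcal{V},\mathcal{E})$ be the associating hypergraph on the Moufang loop $M(D_n,2)$. Then its matching polynomial is $$M(\mathcal{H},w)=\sum_{k=0}^{\,n+\lfloor n/3\rfloor} a_k\, w_1^{4n-3k}\, w_2^{k},$$ where $a_k$ is the number of $k$-matchings of $\mathcal{H}$ (and $a_k\neq 0$ exactly for $0\le k\le n+\lfloor n/3\rfloor$).
   Context: Let $D_n=\langle x,y\mid x^n=y^2=1,\ xy=yx^{ -1}\rangle$ be the dihedral group of order $2n$. The Moufang loop $M(D_n,2)$ is the set $\{(g,\alpha): g\in D_n,\ \alpha\in\mathbb{Z}_2\}$ (of size $4n$) with the operation $(g_1,\alpha_1)\circ(g_2,\alpha_2)=\big(g_1^{1-\alpha_2}\, g_2^{(-1)^{\alpha_1}}\, g_1^{\alpha_2},\ \alpha_1+\alpha_2\big)$, where $\alpha_i\in\{0,1\}$ are used as integer exponents. The associating hypergraph $\mathcal{H}(\mathcal{V},\mathcal{E})$ has vertex set $\mathcal{V}=M(D_n,2)$, and its hyperedges are the triples of three pairwise distinct elements $a,b,c$, taken in an order $(a,b,c)$, such that $(a\circ b)\circ c=a\circ(b\circ c)$ (a 3-uniform directed hypergraph). A $k$-matching is a set of $k$ hyperedges, no two sharing a vertex. For a 3-uniform hypergraph on $N$ vertices, the matching polynomial with vertex weight $w_1$ and hyperedge weight $w_2$ is $M(\mathcal{H},w)=\sum_{k\ge 0} a_k\, w_1^{N-3k} w_2^{k}$, i.e. each matching contributes $w_1$ for each vertex it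 does not cover and $w_2$ for each of its hyperedges. -}

module Defs where

open import Data.Nat using (ℕ; _+_; _∸_; NonZero)
open import Data.Nat.DivMod using (_%_; m%n<n)
open import Data.Fin using (Fin; toℕ; fromℕ<)
open import Data.Bool using (Bool; true; false; _xor_)
open import Data.Product using (_×_; _,_; Σ)
open import Data.List using (List; []; _∷_; _++_)
open import Data.Vec using (Vec; []; _∷_)
open import Data.List.Relation.Unary.Unique.Propositional using (Unique)
open import Relation.Binary.PropositionalEquality using (_≡_; _≢_)

module _ (n : ℕ) .{{_ : NonZero n}} where

  _⊕_ : Fin n → Fin n → Fin n
  a ⊕ b = fromℕ< (m%n<n (toℕ a + toℕ b) n)

  ⊖_ : Fin n → Fin n
  ⊖ a = fromℕ< (m%n<n (n ∸ toℕ a) n)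

  -- Dihedral group D_n of order 2n: (i , s) stands for x^i y^s
  -- (s = true means the factor y is present).
  D : Set
  D = Fin n × Bool

  -- x^i y^s · x^j y^t = x^(i + (-1)^s j) y^(s+t)   (using y x = x^{-1} y)
  dmul : D → D → D
  dmul (i , false) (j , t) = (i ⊕ j , t)
  dmul (i , true)  (j , t) = (i ⊕ (⊖ j) , true xor t)

  dinv : D → D
  dinv (i , false) = (⊖ i , false)
  dinv (i , true)  = (i , true)

  -- The Moufang loop M(D_n,2): elements (g , α), α ∈ ℤ₂ (false = 0, true = 1)
  M : Set
  M = D × Bool

  pw : Bool → D → D
  pw false g = g
  pw true  g = dinv g

  -- (g1,α1)∘(g2,α2) = (g1^{1-α2} g2^{(-1)^{α1}} g1^{α2}, α1+α2)
  _∘_ : M → M → M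
  (g₁ , α₁) ∘ (g₂ , false) = (dmul g₁ (pw α₁ g₂) , α₁ xor false)
  (g₁ , α₁) ∘ (g₂ , true)  = (dmul (pw α₁ g₂) g₁ , α₁ xor true)

  record Hyperedge : Set where
    constructor edge
    field
      a b c : M
      a≢b : a ≢ b
      b≢c : b ≢ c
      a≢c : a ≢ c
      assoc : ((a ∘ b) ∘ c) ≡ (a ∘ (b ∘ c))

  vertices : Hyperedge → List M
  vertices e = Hyperedge.a e ∷ Hyperedge.b e ∷ Hyperedge.c e ∷ []

  allVertices : {k : ℕ} → Vec Hyperedge k → List M
  allVertices [] = []
  allVertices (e ∷ es) = vertices e ++ allVertices es

  -- A k-matching: k hyperedges, no two sharing a vertex; listed as a vector
  -- whose 3k covered vertices are pairwise distinct.
  IsMatching : {k : ℕ} → Vec Hyperedge k → Set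
  IsMatching es = Unique (allVertices es)

  -- a_k ≠ 0, i.e. H has at least one k-matching
  HasMatching : ℕ → Set
  HasMatching k = Σ (Vec Hyperedge k) IsMatching

-- Upper bound: a k-matching covers 3k distinct elements of the 4n-element loop, so 3k ≤ 4n.
-- Lower bound: split M(D_n,2) into the four layers {((x^i y^s) , α) | i ∈ ℤ_n} indexed by
-- (s , α). Any three elements of one layer associate, an identity in the abelian group ℤ_n.
-- Writing n = r + 3q with r < 3, the indices r, …, n-1 of each layer therefore give 4q disjoint
-- hyperedges, and the 4r elements of index < r contain r more disjoint associating triples.
-- This is a matching with r + 4q = n + ⌊n/3⌋ hyperedges, and sub-matchings give all smaller k.
module Submission where

open import Defs
open import Level using (0ℓ)
open import Algebra.Bundles using (AbelianGroup)
open import Algebra.Consequences.Propositional using (comm∧idˡ⇒id; comm∧invˡ⇒inv)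
open import Data.Bool as Bool using (Bool; true; false)
open import Data.Fin as Fin using (Fin; zero; suc; toℕ; fromℕ<; _↑ʳ_; combine)
open import Data.Fin.Patterns using (0F; 1F; 2F)
open import Data.Fin.Properties
  using (toℕ-fromℕ<; fromℕ<-cong; fromℕ<-toℕ; toℕ<n; toℕ≤n; injective⇒≤; 2↔Bool; *↔×;
         ↑ʳ-injective; toℕ-↑ʳ; combine-injective)
open import Data.List using (List; []; _∷_; _++_; length; lookup; map; cartesianProductWith; cartesianProduct; allFin)
open import Data.List.Properties using (length-++; length-map; length-tabulate)
open import Data.List.Membership.Propositional using (_∈_)
open import Data.List.Membership.Propositional.Properties using (∈-lookup; ∈-cartesianProductWith⁻)
open import Data.List.Relation.Binary.Disjoint.Propositional using (Disjoint)
open import Data.List.Relation.Unary.All as All using (All; []; _∷_)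
open import Data.List.Relation.Unary.AllPairs using ([]; _∷_)
open import Data.List.Relation.Unary.Unique.DecPropositional using (unique?)
open import Data.List.Relation.Unary.Unique.Propositional using (Unique)
open import Data.List.Relation.Unary.Unique.Propositional.Properties
  using (++⁺; cartesianProductWith⁺; cartesianProduct⁺; allFin⁺)
open import Data.Nat using (ℕ; zero; suc; NonZero; _+_; _*_; _∸_; _≤_; _<_; _≤′_; ≤′-refl; ≤′-step; z<s; s<s)
open import Data.Nat.Divisibility using (n∣m*n)
open import Data.Nat.DivMod
  using (_%_; _/_; m%n<n; m≡m%n+[m/n]*n; m*n/n≡m; /-monoˡ-≤; +-distrib-/-∣ˡ; %-distribˡ-+;
         m%n%n≡m%n; m<n⇒m%n≡m; [m+n]%n≡m%n)
open import Data.Nat.Properties as ℕ using (m∸n+n≡m; ≤⇒≤′; m≤m+n; <⇒≱; module ≤-Reasoning)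
open import Data.Nat.Tactic.RingSolver using (solve-∀)
open import Data.Product using (_×_; _,_)
open import Data.Product.Function.NonDependent.Propositional using (_×-↔_)
open import Data.Product.Properties using (≡-dec)
open import Data.Vec using (Vec; []; _∷_)
open import Function.Base using (id)
open import Function.Bundles using (_↣_; _↔_; _⇔_; mk⇔; Injection)
open import Function.Definitions using (Injective)
open import Function.Properties.Inverse using (↔-refl; ↔-sym; ↔-trans; ↔⇒↣)
open import Relation.Binary.Definitions using (DecidableEquality)
open import Relation.Binary.PropositionalEquality
  using (_≡_; refl; sym; trans; subst; cong; cong₂; isEquivalence; module ≡-Reasoning)
open import Relation.Nullary using (contradiction)
open import Relation.Nullary.Decidable using (from-yes)

length-cartesianProductWith : ∀ {A B C : Set} (f : A → B → C) xs ys →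
  length (cartesianProductWith f xs ys) ≡ length xs * length ys
length-cartesianProductWith f [] ys = refl
length-cartesianProductWith f (x ∷ xs) ys = begin
  length (map (f x) ys ++ cartesianProductWith f xs ys)
    ≡⟨ length-++ (map (f x) ys) ⟩
  length (map (f x) ys) + length (cartesianProductWith f xs ys)
    ≡⟨ cong₂ _+_ (length-map (f x) ys) (length-cartesianProductWith f xs ys) ⟩
  length ys + length xs * length ys
    ∎
  where open ≡-Reasoning

module _ {A : Set} where

  Unique⇒lookup-injective : ∀ {xs : List A} → Unique xs → Injective _≡_ _≡_ (lookup xs)
  Unique⇒lookup-injective (_ ∷ _)  {zero}  {zero}  _  = refl
  Unique⇒lookup-injective (x∉ ∷ _) {zero}  {suc j} eq = contradiction eq (All.lookup x∉ (∈-lookup j))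
  Unique⇒lookup-injective (x∉ ∷ _) {suc i} {zero}  eq = contradiction (sym eq) (All.lookup x∉ (∈-lookup i))
  Unique⇒lookup-injective (_ ∷ u)  {suc i} {suc j} eq = cong suc (Unique⇒lookup-injective u eq)

  Unique⇒length≤ : ∀ {N} {xs : List A} → A ↣ Fin N → Unique xs → length xs ≤ N
  Unique⇒length≤ f u = injective⇒≤ (λ eq → Unique⇒lookup-injective u (Injection.injective f eq))

  data Triples (R : A → A → A → Set) : List A → ℕ → Set where
    []  : Triples R [] 0
    _∷_ : ∀ {a b c vs k} → R a b c → Triples R vs k → Triples R (a ∷ b ∷ c ∷ vs) (suc k)

  _++ᵗ_ : ∀ {R vs ws k l} → Triples R vs k → Triples R ws l → Triples R (vs ++ ws) (k + l)
  []       ++ᵗ us = us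
  (t ∷ ts) ++ᵗ us = t ∷ (ts ++ᵗ us)

  triples-cartesianProductWith : ∀ {B : Set} {R} (f : B → Fin 3 → A) (xs : List B) →
    (∀ x → R (f x 0F) (f x 1F) (f x 2F)) →
    Triples R (cartesianProductWith f xs (allFin 3)) (length xs)
  triples-cartesianProductWith f []       _  = []
  triples-cartesianProductWith f (x ∷ xs) Rf = Rf x ∷ triples-cartesianProductWith f xs Rf

-- rotᵅ and refᵅ: the rotations x^i, resp. the reflections x^i y, of D_n paired with α.
Layer : Set
Layer = Bool × Bool

rot₀ rot₁ ref₀ ref₁ : Layer
rot₀ = false , false
rot₁ = false , true
ref₀ = true  , false
ref₁ = true  , true

layers : List Layer
layers = rot₀ ∷ rot₁ ∷ ref₀ ∷ ref₁ ∷ []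

layers-unique : Unique layers
layers-unique = from-yes (unique? (≡-dec Bool._≟_ Bool._≟_) layers)

module ℤₙ (n : ℕ) .{{_ : NonZero n}} where

  open import Algebra.Definitions {A = Fin n} _≡_

  -- a ⊕ b and ⊖ a are definitionally [ toℕ a + toℕ b ] and [ n ∸ toℕ a ], so each group
  -- law below reduces to a congruence modulo n.
  [_] : ℕ → Fin n
  [ m ] = fromℕ< (m%n<n m n)

  []-cong : ∀ {m m′} → m % n ≡ m′ % n → [ m ] ≡ [ m′ ]
  []-cong {m} {m′} eq = fromℕ<-cong (m % n) (m′ % n) eq (m%n<n m n) (m%n<n m′ n)

  []-toℕ : ∀ a → [ toℕ a ] ≡ a
  []-toℕ a = trans (fromℕ<-cong _ _ (m<n⇒m%n≡m (toℕ<n a)) (m%n<n (toℕ a) n) (toℕ<n a))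
                   (fromℕ<-toℕ a (toℕ<n a))

  [[m]+k]≡[m+k] : ∀ m k → [ toℕ [ m ] + k ] ≡ [ m + k ]
  [[m]+k]≡[m+k] m k = []-cong (begin
    (toℕ [ m ] + k) % n      ≡⟨ cong (λ x → (x + k) % n) (toℕ-fromℕ< (m%n<n m n)) ⟩
    (m % n + k) % n          ≡⟨ %-distribˡ-+ (m % n) k n ⟩
    (m % n % n + k % n) % n  ≡⟨ cong (λ x → (x + k % n) % n) (m%n%n≡m%n m n) ⟩
    (m % n + k % n) % n      ≡⟨ %-distribˡ-+ m k n ⟨
    (m + k) % n              ∎)
    where open ≡-Reasoning

  [m+[k]]≡[m+k] : ∀ m k → [ m + toℕ [ k ] ] ≡ [ m + k ]
  [m+[k]]≡[m+k] m k = begin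
    [ m + toℕ [ k ] ]  ≡⟨ cong [_] (ℕ.+-comm m _) ⟩
    [ toℕ [ k ] + m ]  ≡⟨ [[m]+k]≡[m+k] k m ⟩
    [ k + m ]          ≡⟨ cong [_] (ℕ.+-comm k m) ⟩
    [ m + k ]          ∎
    where open ≡-Reasoning

  0# : Fin n
  0# = [ 0 ]

  +-assoc : Associative (_⊕_ n)
  +-assoc a b c = begin
    [ toℕ [ toℕ a + toℕ b ] + toℕ c ]  ≡⟨ [[m]+k]≡[m+k] (toℕ a + toℕ b) (toℕ c) ⟩
    [ toℕ a + toℕ b + toℕ c ]          ≡⟨ cong [_] (ℕ.+-assoc (toℕ a) (toℕ b) (toℕ c)) ⟩
    [ toℕ a + (toℕ b + toℕ c) ]        ≡⟨ [m+[k]]≡[m+k] (toℕ a) (toℕ b + toℕ c) ⟨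
    [ toℕ a + toℕ [ toℕ b + toℕ c ] ]  ∎
    where open ≡-Reasoning

  +-comm : Commutative (_⊕_ n)
  +-comm a b = cong [_] (ℕ.+-comm (toℕ a) (toℕ b))

  +-identityˡ : LeftIdentity 0# (_⊕_ n)
  +-identityˡ a = trans ([[m]+k]≡[m+k] 0 (toℕ a)) ([]-toℕ a)

  -‿inverseˡ : LeftInverse 0# (⊖_ n) (_⊕_ n)
  -‿inverseˡ a = begin
    [ toℕ [ n ∸ toℕ a ] + toℕ a ]  ≡⟨ [[m]+k]≡[m+k] (n ∸ toℕ a) (toℕ a) ⟩
    [ n ∸ toℕ a + toℕ a ]          ≡⟨ cong [_] (m∸n+n≡m (toℕ≤n a)) ⟩
    [ n ]                          ≡⟨ []-cong ([m+n]%n≡m%n 0 n) ⟩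
    [ 0 ]                          ∎
    where open ≡-Reasoning

  abelianGroup : AbelianGroup 0ℓ 0ℓ
  abelianGroup = record
    { Carrier = Fin n
    ; _≈_ = _≡_
    ; _∙_ = _⊕_ n
    ; ε = 0#
    ; _⁻¹ = ⊖_ n
    ; isAbelianGroup = record
      { isGroup = record
        { isMonoid = record
          { isSemigroup = record
            { isMagma = record { isEquivalence = isEquivalence ; ∙-cong = cong₂ (_⊕_ n) }
            ; assoc = +-assoc
            }
          ; identity = comm∧idˡ⇒id +-comm +-identityˡ
          }
        ; inverse = comm∧invˡ⇒inv +-comm -‿inverseˡ
        ; ⁻¹-cong = cong (⊖_ n)
        }
      ; comm = +-comm
      }
    }

module AssociatingHypergraph (n : ℕ) .{{_ : NonZero n}} where

  open AbelianGroup (ℤₙ.abelianGroup n)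
    using (_∙_; _⁻¹; ε; assoc; comm; identityʳ; commutativeSemigroup)
  open import Algebra.Properties.AbelianGroup (ℤₙ.abelianGroup n)
  open import Algebra.Properties.CommutativeSemigroup commutativeSemigroup
  open ≡-Reasoning

  at : Fin n → Layer → M n
  at i (s , α) = (i , s) , α

  index : M n → Fin n
  index ((i , _) , _) = i

  at-injective : ∀ {i j ℓ ℓ′} → at i ℓ ≡ at j ℓ′ → i ≡ j × ℓ ≡ ℓ′
  at-injective {ℓ = _ , _} {_ , _} refl = refl , refl

  _≟_ : DecidableEquality (M n)
  _≟_ = ≡-dec (≡-dec Fin._≟_ Bool._≟_) Bool._≟_

  Assoc : M n → M n → M n → Set
  Assoc a b c = _∘_ n (_∘_ n a b) c ≡ _∘_ n a (_∘_ n b c)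

  layer-assoc : ∀ ℓ i j k → Assoc (at i ℓ) (at j ℓ) (at k ℓ)
  layer-assoc (false , false) i j k = cong (λ x → at x rot₀) (assoc i j k)
  layer-assoc (false , true)  i j k = cong (λ x → at x rot₁) (begin
    k ∙ (j ⁻¹ ∙ i)        ≡⟨ x∙yz≈z∙xy k (j ⁻¹) i ⟩
    i ∙ (k ∙ j ⁻¹)        ≡⟨ cong (i ∙_) (⁻¹-anti-homo‿- j k) ⟨
    i ∙ (j ∙ k ⁻¹) ⁻¹     ≡⟨ cong (λ x → i ∙ x ⁻¹) (comm j (k ⁻¹)) ⟩
    i ∙ (k ⁻¹ ∙ j) ⁻¹     ∎)
  layer-assoc (true , false)  i j k = cong (λ x → at x ref₀) (begin
    i ∙ j ⁻¹ ∙ k          ≡⟨ xy∙z≈x∙zy i (j ⁻¹) k ⟩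
    i ∙ (k ∙ j ⁻¹)        ≡⟨ cong (i ∙_) (⁻¹-anti-homo‿- j k) ⟨
    i ∙ (j ∙ k ⁻¹) ⁻¹     ∎)
  layer-assoc (true , true)   i j k = cong (λ x → at x ref₁) (begin
    k ∙ (j ∙ i ⁻¹) ⁻¹     ≡⟨ cong (k ∙_) (⁻¹-anti-homo‿- j i) ⟩
    k ∙ (i ∙ j ⁻¹)        ≡⟨ x∙yz≈y∙xz k i (j ⁻¹) ⟩
    i ∙ (k ∙ j ⁻¹)        ≡⟨ cong (i ∙_) (⁻¹-involutive (k ∙ j ⁻¹)) ⟨
    i ∙ (k ∙ j ⁻¹) ⁻¹ ⁻¹  ∎)

  -- With a first index i in place of ε this holds only when i ∙ i ≡ ε.
  rot₀-rot₁-ref₀-assoc : ∀ j k → Assoc (at ε rot₀) (at j rot₁) (at k ref₀)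
  rot₀-rot₁-ref₀-assoc j k = cong (λ x → at x ref₁) (begin
    j ∙ ε ∙ k             ≡⟨ cong (_∙ k) (identityʳ j) ⟩
    j ∙ k                 ≡⟨ identityʳ (j ∙ k) ⟨
    j ∙ k ∙ ε             ≡⟨ cong (j ∙ k ∙_) ε⁻¹≈ε ⟨
    j ∙ k ∙ ε ⁻¹          ∎)

  ref₁-rot₀-ref₁-assoc : ∀ i j k → Assoc (at i ref₁) (at j rot₀) (at k ref₁)
  ref₁-rot₀-ref₁-assoc i j k = cong (λ x → at x rot₀) (begin
    k ∙ (i ∙ j ⁻¹ ⁻¹) ⁻¹  ≡⟨ cong (λ x → k ∙ (i ∙ x) ⁻¹) (⁻¹-involutive j) ⟩
    k ∙ (i ∙ j) ⁻¹        ≡⟨ cong (k ∙_) (⁻¹-anti-homo-∙ i j) ⟩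
    k ∙ (j ⁻¹ ∙ i ⁻¹)     ≡⟨ assoc k (j ⁻¹) (i ⁻¹) ⟨
    k ∙ j ⁻¹ ∙ i ⁻¹       ∎)

  hyperedges : ∀ {vs k} → Unique vs → Triples Assoc vs k → Vec (Hyperedge n) k
  hyperedges _ [] = []
  hyperedges ((a≢b ∷ a≢c ∷ _) ∷ (b≢c ∷ _) ∷ _ ∷ u) (abc ∷ ts) =
    edge _ _ _ a≢b b≢c a≢c abc ∷ hyperedges u ts

  allVertices-hyperedges : ∀ {vs k} (u : Unique vs) (ts : Triples Assoc vs k) →
    allVertices n (hyperedges u ts) ≡ vs
  allVertices-hyperedges _ [] = refl
  allVertices-hyperedges ((_ ∷ _ ∷ _) ∷ (_ ∷ _) ∷ _ ∷ u) (_∷_ {a} {b} {c} _ ts) =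
    cong (λ ws → a ∷ b ∷ c ∷ ws) (allVertices-hyperedges u ts)

  triples⇒hasMatching : ∀ {vs k} → Unique vs → Triples Assoc vs k → HasMatching n k
  triples⇒hasMatching u ts = hyperedges u ts , subst Unique (sym (allVertices-hyperedges u ts)) u

  hasMatching-pred : ∀ {k} → HasMatching n (suc k) → HasMatching n k
  hasMatching-pred (_ ∷ es , _ ∷ _ ∷ _ ∷ u) = es , u

  hasMatching-≤ : ∀ {k m} → k ≤ m → HasMatching n m → HasMatching n k
  hasMatching-≤ k≤m = go (≤⇒≤′ k≤m)
    where
    go : ∀ {k m} → k ≤′ m → HasMatching n m → HasMatching n k
    go ≤′-refl         h = h
    go (≤′-step k≤′m) h = go k≤′m (hasMatching-pred h)

  length-allVertices : ∀ {k} (es : Vec (Hyperedge n) k) → length (allVertices n es) ≡ k * 3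
  length-allVertices []       = refl
  length-allVertices (_ ∷ es) = cong (3 +_) (length-allVertices es)

  M↔Fin : M n ↔ Fin (n * 2 * 2)
  M↔Fin = ↔-trans ((↔-trans (↔-refl ×-↔ ↔-sym 2↔Bool) (↔-sym *↔×)) ×-↔ ↔-sym 2↔Bool) (↔-sym *↔×)

  hasMatching⇒k*3≤n*2*2 : ∀ {k} → HasMatching n k → k * 3 ≤ n * 2 * 2
  hasMatching⇒k*3≤n*2*2 (es , u) =
    subst (_≤ n * 2 * 2) (length-allVertices es) (Unique⇒length≤ (↔⇒↣ M↔Fin) u)

-- Block (ℓ , t) is the triple of layer ℓ with indices r + 3t, r + 3t + 1, r + 3t + 2.
module Blocks (r q : ℕ) .{{_ : NonZero (r + q * 3)}} where

  open AssociatingHypergraph (r + q * 3)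

  slots : List (Layer × Fin q)
  slots = cartesianProduct layers (allFin q)

  blockVertex : Layer × Fin q → Fin 3 → M (r + q * 3)
  blockVertex (ℓ , t) o = at (r ↑ʳ combine t o) ℓ

  blocks : List (M (r + q * 3))
  blocks = cartesianProductWith blockVertex slots (allFin 3)

  blockVertex-injective : ∀ {x y o o′} → blockVertex x o ≡ blockVertex y o′ → x ≡ y × o ≡ o′
  blockVertex-injective {_ , t} {_ , t′} {o} {o′} eq with at-injective eq
  ... | i≡i′ , refl with combine-injective t o t′ o′ (↑ʳ-injective r _ _ i≡i′)
  ... | refl , refl = refl , refl

  blocks-unique : Unique blocks
  blocks-unique = cartesianProductWith⁺ blockVertex blockVertex-injective
    (cartesianProduct⁺ layers-unique (allFin⁺ q)) (allFin⁺ 3)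

  length-slots : length slots ≡ 4 * q
  length-slots = trans (length-cartesianProductWith _,_ layers (allFin q))
                       (cong (4 *_) (length-tabulate {n = q} id))

  blocks-triples : Triples Assoc blocks (4 * q)
  blocks-triples = subst (Triples Assoc blocks) length-slots
    (triples-cartesianProductWith blockVertex slots (λ (ℓ , _) → layer-assoc ℓ _ _ _))

  r≤blocks-index : ∀ {v} → v ∈ blocks → r ≤ toℕ (index v)
  r≤blocks-index v∈blocks with ∈-cartesianProductWith⁻ blockVertex slots (allFin 3) v∈blocks
  ... | (_ , t) , o , _ , _ , refl = subst (r ≤_) (sym (toℕ-↑ʳ r (combine t o))) (m≤m+n r _)

  extend-with-blocks : ∀ {vs} → Unique vs → Triples Assoc vs r → All (λ v → toℕ (index v) < r) vs →
    HasMatching (r + q * 3) (r + 4 * q)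
  extend-with-blocks {vs} u ts below =
    triples⇒hasMatching (++⁺ u blocks-unique disjoint) (ts ++ᵗ blocks-triples)
    where
    disjoint : Disjoint vs blocks
    disjoint (v∈vs , v∈blocks) = <⇒≱ (All.lookup below v∈vs) (r≤blocks-index v∈blocks)

hasMatching-r+4q : ∀ r q .{{_ : NonZero (r + q * 3)}} → r < 3 → HasMatching (r + q * 3) (r + 4 * q)
hasMatching-r+4q 0 q _ = extend-with-blocks [] [] []
  where open Blocks 0 q
hasMatching-r+4q 1 q _ =
  extend-with-blocks (from-yes (unique? _≟_ vs)) (rot₀-rot₁-ref₀-assoc 0F 0F ∷ []) (z<s ∷ z<s ∷ z<s ∷ [])
  where
  open Blocks 1 q
  open AssociatingHypergraph (1 + q * 3)
  vs : List (M (1 + q * 3))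
  vs = at 0F rot₀ ∷ at 0F rot₁ ∷ at 0F ref₀ ∷ []
hasMatching-r+4q 2 q _ =
  extend-with-blocks (from-yes (unique? _≟_ vs))
    (rot₀-rot₁-ref₀-assoc 0F 0F ∷ ref₁-rot₀-ref₁-assoc 0F 1F 1F ∷ [])
    (z<s ∷ z<s ∷ z<s ∷ z<s ∷ s<s z<s ∷ s<s z<s ∷ [])
  where
  open Blocks 2 q
  open AssociatingHypergraph (2 + q * 3)
  vs : List (M (2 + q * 3))
  vs = at 0F rot₀ ∷ at 0F rot₁ ∷ at 0F ref₀ ∷ at 0F ref₁ ∷ at 1F rot₀ ∷ at 1F ref₁ ∷ []
hasMatching-r+4q (suc (suc (suc _))) q (s<s (s<s (s<s ())))

hasMatching-n+n/3 : ∀ n .{{_ : NonZero n}} → HasMatching n (n + n / 3)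
hasMatching-n+n/3 n =
  subst (HasMatching n) r+4q≡n+q (from-decomposition {n % 3} {n / 3} (m≡m%n+[m/n]*n n 3) (m%n<n n 3))
  where
  from-decomposition : ∀ {r q} → n ≡ r + q * 3 → r < 3 → HasMatching n (r + 4 * q)
  from-decomposition {r} {q} refl = hasMatching-r+4q r q

  r+4q≡r+q*3+q : ∀ r q → r + 4 * q ≡ r + q * 3 + q
  r+4q≡r+q*3+q = solve-∀

  r+4q≡n+q : n % 3 + 4 * (n / 3) ≡ n + n / 3
  r+4q≡n+q = trans (r+4q≡r+q*3+q (n % 3) (n / 3)) (cong (_+ n / 3) (sym (m≡m%n+[m/n]*n n 3)))

m*3≤n*2*2⇒m≤n+n/3 : ∀ m n → m * 3 ≤ n * 2 * 2 → m ≤ n + n / 3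
m*3≤n*2*2⇒m≤n+n/3 m n m*3≤n*2*2 = begin
  m                  ≡⟨ m*n/n≡m m 3 ⟨
  m * 3 / 3          ≤⟨ /-monoˡ-≤ 3 m*3≤n*2*2 ⟩
  n * 2 * 2 / 3      ≡⟨ cong (_/ 3) (n*2*2≡n*3+n n) ⟩
  (n * 3 + n) / 3    ≡⟨ +-distrib-/-∣ˡ n (n∣m*n n) ⟩
  n * 3 / 3 + n / 3  ≡⟨ cong (_+ n / 3) (m*n/n≡m n 3) ⟩
  n + n / 3          ∎
  where
  open ≤-Reasoning
  n*2*2≡n*3+n : ∀ n → n * 2 * 2 ≡ n * 3 + n
  n*2*2≡n*3+n = solve-∀

theorem4p11 : (n : ℕ) .{{_ : NonZero n}} → 3 ≤ n →
    (k : ℕ) → HasMatching n k ⇔ k ≤ n + n / 3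
theorem4p11 n _ k = mk⇔
  (λ k-matching → m*3≤n*2*2⇒m≤n+n/3 k n (hasMatching⇒k*3≤n*2*2 k-matching))
  (λ k≤n+n/3 → hasMatching-≤ k≤n+n/3 (hasMatching-n+n/3 n))
  where open AssociatingHypergraph n
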